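{- The wall $W$ is $3$-monotone bipartite; that is, $W$ is bipartite and there exist total orderings of its two colour classes such that $E(W)$ is the union of three monotone matchings.
   Context: The wall is the infinite graph $W$ with vertex set $\mathbb{Z}^2$ and edge set $\{(x,y)(x+1,y): x,y\in\mathbb{Z}\}\cup\{(x,y)(x,y+1): x,y\in\mathbb{Z},\ x+y \text{ even}\}$. For a bipartite graph with totally ordered colour classes, edges $vw$ and $v'w'$ (with $v,v'$ in the first class and $w,w'$ in the second) cross if $v\prec v'$ and $w'\prec w$; a matching is monotone if no two of its edges cross. -}

module Defs where

open import Level using (0ℓ)
open import Data.Bool using (Bool; true; false)
open import Data.Integer using (ℤ; _+_; 1ℤ)
open import Data.Integer.Divisibility using (_∣_)
open import Data.Product using (Σ; _×_; _,_)
open import Data.Sum using (_⊎_)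
open import Data.Empty using (⊥)
open import Relation.Nullary using (¬_)
open import Relation.Binary.PropositionalEquality using (_≡_)
open import Relation.Binary.Structures using (IsStrictTotalOrder)

V : Set
V = ℤ × ℤ

Even : ℤ → Set
Even n = (Data.Integer.+ 2) ∣ n

Adj : V → V → Set
Adj (x , y) (x' , y') =
    (x' ≡ x + 1ℤ × y' ≡ y)
  ⊎ (x ≡ x' + 1ℤ × y ≡ y')
  ⊎ (x' ≡ x × y' ≡ y + 1ℤ × Even (x + y))
  ⊎ (x ≡ x' × y ≡ y' + 1ℤ × Even (x' + y'))

ProperColouring : (V → Bool) → Set
ProperColouring c = ∀ u v → Adj u v → ¬ (c u ≡ c v)

Class : (V → Bool) → Bool → Set
Class c b = Σ V (λ v → c v ≡ b)

vert : ∀ {c b} → Class c b → V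
vert (v , _) = v

-- A set of edges, each edge written with its first-class endpoint first.
EdgeSet : (V → Bool) → Set₁
EdgeSet c = Class c false → Class c true → Set

IsMatching : (c : V → Bool) → EdgeSet c → Set
IsMatching c M =
    (∀ v w → M v w → Adj (vert v) (vert w))
  × (∀ v w w' → M v w → M v w' → w ≡ w')
  × (∀ v v' w → M v w → M v' w → v ≡ v')

IsMonotone : (c : V → Bool)
           → (Class c false → Class c false → Set)
           → (Class c true → Class c true → Set)
           → EdgeSet c → Set
IsMonotone c _≺₁_ _≺₂_ M =
  ∀ v w v' w' → M v w → M v' w' → v ≺₁ v' → w' ≺₂ w → ⊥

ThreeMonotoneBipartite : Set₁
ThreeMonotoneBipartite =
  Σ (V → Bool) λ c → ProperColouring c ×
  Σ (Class c false → Class c false → Set) λ _≺₁_ →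
  Σ (Class c true → Class c true → Set) λ _≺₂_ →
    IsStrictTotalOrder _≡_ _≺₁_ × IsStrictTotalOrder _≡_ _≺₂_ ×
  Σ (EdgeSet c) λ M₁ → Σ (EdgeSet c) λ M₂ → Σ (EdgeSet c) λ M₃ →
      (IsMatching c M₁ × IsMonotone c _≺₁_ _≺₂_ M₁)
    × (IsMatching c M₂ × IsMonotone c _≺₁_ _≺₂_ M₂)
    × (IsMatching c M₃ × IsMonotone c _≺₁_ _≺₂_ M₃)
    × (∀ v w → Adj (vert v) (vert w) → M₁ v w ⊎ M₂ v w ⊎ M₃ v w)

module Submission where

open import Defs
open import Level using (Level; 0ℓ)
open import Data.Bool using (Bool; true; false; not)
open import Data.Bool.Properties using (_≟_; not-¬; not-involutive)
open import Data.Empty using (⊥-elim)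
open import Data.Integer using (ℤ; +_; -[1+_]; _+_; _<_; 1ℤ; ∣_∣)
open import Data.Integer.Properties using (+-assoc; +-comm; +-monoˡ-<; <-isStrictTotalOrder)
open import Data.Nat as ℕ using (ℕ; zero; suc)
import Data.Nat.Properties as ℕ
open import Data.Nat.Divisibility using (_∣_; divides)
open import Data.Product using (_,_)
open import Data.Product.Relation.Binary.Lex.Strict using (×-Lex; ×-isStrictTotalOrder)
open import Data.Product.Relation.Binary.Pointwise.NonDependent using (≡×≡⇒≡)
open import Data.Sum using (_⊎_; inj₁; inj₂)
open import Function using (_on_)
open import Relation.Binary.Core using (Rel; _⇒_; _Preserves_⟶_)
open import Relation.Binary.Definitions using (Trichotomous; tri<; tri≈; tri>)
open import Relation.Binary.Structures using (IsStrictTotalOrder)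
open import Relation.Binary.PropositionalEquality
import Relation.Binary.Construct.On as On
open import Axiom.UniquenessOfIdentityProofs using (module Decidable⇒UIP)

-- Colour (x, y) by the parity of x + y and order both colour classes
-- lexicographically. Every edge of the wall joins v to v + (1,0) or to
-- v + (0,1), and in the first colour class (x + y even) the vertical edges
-- all go up. So E(W) is covered by the graphs of v ↦ v + (1,0) and
-- v ↦ v + (0,1) from the first class to the second, and of v ↦ v + (1,0)
-- from the second class to the first. Translations are strictly monotone,
-- hence injective, for the lexicographic order, so each of these graphs is a
-- monotone matching.

module _ {a ℓ₁ ℓ₂ : Level} {A : Set a} {_≈_ : Rel A ℓ₁} {_<_ : Rel A ℓ₂} where

  isStrictTotalOrder-≡ : _≈_ ⇒ _≡_ → IsStrictTotalOrder _≈_ _<_ → IsStrictTotalOrder _≡_ _<_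
  isStrictTotalOrder-≡ ≈⇒≡ sto = record
    { isStrictPartialOrder = record
      { isEquivalence = isEquivalence
      ; irrefl        = λ { refl → irrefl Eq.refl }
      ; trans         = <-trans
      ; <-resp-≈      = (λ { refl x<y → x<y }) , (λ { refl x<y → x<y })
      }
    ; compare = compare≡
    }
    where
    open IsStrictTotalOrder sto using (module Eq; irrefl; compare) renaming (trans to <-trans)
    compare≡ : Trichotomous _≡_ _<_
    compare≡ x y with compare x y
    ... | tri< x<y x≉y y≮x = tri< x<y (λ { refl → x≉y Eq.refl }) y≮x
    ... | tri≈ x≮y x≈y y≮x = tri≈ x≮y (≈⇒≡ x≈y) y≮x
    ... | tri> x≮y x≉y y<x = tri> x≮y (λ { refl → x≉y Eq.refl }) y<x

module _ {a ℓ : Level} {A : Set a} {_<_ : Rel A ℓ} (sto : IsStrictTotalOrder _≡_ _<_) where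

  open IsStrictTotalOrder sto using (irrefl; compare)

  strictlyMonotone⇒injective : ∀ {f : A → A} → f Preserves _<_ ⟶ _<_ →
                               ∀ {x y} → f x ≡ f y → x ≡ y
  strictlyMonotone⇒injective mono {x} {y} fx≡fy with compare x y
  ... | tri< x<y _ _ = ⊥-elim (irrefl fx≡fy (mono x<y))
  ... | tri≈ _ x≡y _ = x≡y
  ... | tri> _ _ y<x = ⊥-elim (irrefl (sym fx≡fy) (mono y<x))

oddℕ : ℕ → Bool
oddℕ zero    = false
oddℕ (suc n) = not (oddℕ n)

odd : ℤ → Bool
odd z = oddℕ ∣ z ∣

odd-+1 : ∀ z → odd (z + 1ℤ) ≡ not (odd z)
odd-+1 (+ n)          = cong oddℕ (ℕ.+-comm n 1)
odd-+1 -[1+ zero ]    = refl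
odd-+1 -[1+ suc n ]   = sym (not-involutive (oddℕ (suc n)))

oddℕ≡false⇒2∣ : ∀ n → oddℕ n ≡ false → 2 ∣ n
oddℕ≡false⇒2∣ zero          _ = divides 0 refl
oddℕ≡false⇒2∣ (suc (suc n)) p with oddℕ≡false⇒2∣ n (trans (sym (not-involutive (oddℕ n))) p)
... | divides q n≡q*2 = divides (suc q) (cong (2 ℕ.+_) n≡q*2)

2∣⇒oddℕ≡false : ∀ {n} → 2 ∣ n → oddℕ n ≡ false
2∣⇒oddℕ≡false (divides q refl) = oddℕ-*2 q
  where
  oddℕ-*2 : ∀ q → oddℕ (q ℕ.* 2) ≡ false
  oddℕ-*2 zero    = refl
  oddℕ-*2 (suc q) = trans (not-involutive (oddℕ (q ℕ.* 2))) (oddℕ-*2 q)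

right : V → V
right (x , y) = (x + 1ℤ , y)

up : V → V
up (x , y) = (x , y + 1ℤ)

colour : V → Bool
colour (x , y) = odd (x + y)

colour-right : ∀ v → colour (right v) ≡ not (colour v)
colour-right (x , y) = begin
  odd ((x + 1ℤ) + y) ≡⟨ cong odd (+-assoc x 1ℤ y) ⟩
  odd (x + (1ℤ + y)) ≡⟨ cong (λ z → odd (x + z)) (+-comm 1ℤ y) ⟩
  odd (x + (y + 1ℤ)) ≡⟨ cong odd (sym (+-assoc x y 1ℤ)) ⟩
  odd ((x + y) + 1ℤ) ≡⟨ odd-+1 (x + y) ⟩
  not (odd (x + y))  ∎
  where open ≡-Reasoning

colour-up : ∀ v → colour (up v) ≡ not (colour v)
colour-up (x , y) = trans (cong odd (sym (+-assoc x y 1ℤ))) (odd-+1 (x + y))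

colour-proper : ProperColouring colour
colour-proper (x , y) _ (inj₁ (refl , refl)) e =
  not-¬ refl (trans e (colour-right (x , y)))
colour-proper _ (x , y) (inj₂ (inj₁ (refl , refl))) e =
  not-¬ refl (trans (sym e) (colour-right (x , y)))
colour-proper (x , y) _ (inj₂ (inj₂ (inj₁ (refl , refl , _)))) e =
  not-¬ refl (trans e (colour-up (x , y)))
colour-proper _ (x , y) (inj₂ (inj₂ (inj₂ (refl , refl , _)))) e =
  not-¬ refl (trans (sym e) (colour-up (x , y)))

colour≡false⇒Even : ∀ {x y} → colour (x , y) ≡ false → Even (x + y)
colour≡false⇒Even {x} {y} = oddℕ≡false⇒2∣ ∣ x + y ∣

Even⇒colour≡false : ∀ {x y} → Even (x + y) → colour (x , y) ≡ false
Even⇒colour≡false = 2∣⇒oddℕ≡false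

_<ₗₑₓ_ : Rel V 0ℓ
_<ₗₑₓ_ = ×-Lex _≡_ _<_ _<_

<ₗₑₓ-isStrictTotalOrder : IsStrictTotalOrder _≡_ _<ₗₑₓ_
<ₗₑₓ-isStrictTotalOrder = isStrictTotalOrder-≡ ≡×≡⇒≡
  (×-isStrictTotalOrder <-isStrictTotalOrder <-isStrictTotalOrder)

open IsStrictTotalOrder <ₗₑₓ-isStrictTotalOrder using (asym)

right-mono-<ₗₑₓ : right Preserves _<ₗₑₓ_ ⟶ _<ₗₑₓ_
right-mono-<ₗₑₓ {_ , _} {_ , _} (inj₁ x<x')         = inj₁ (+-monoˡ-< 1ℤ x<x')
right-mono-<ₗₑₓ {_ , _} {_ , _} (inj₂ (refl , y<y')) = inj₂ (refl , y<y')

up-mono-<ₗₑₓ : up Preserves _<ₗₑₓ_ ⟶ _<ₗₑₓ_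
up-mono-<ₗₑₓ {_ , _} {_ , _} (inj₁ x<x')         = inj₁ x<x'
up-mono-<ₗₑₓ {_ , _} {_ , _} (inj₂ (refl , y<y')) = inj₂ (refl , +-monoˡ-< 1ℤ y<y')

vert-injective : ∀ {c b} {u u' : Class c b} → vert u ≡ vert u' → u ≡ u'
vert-injective {u = v , p} {.v , q} refl = cong (v ,_) (Decidable⇒UIP.≡-irrelevant _≟_ p q)

_≺_ : ∀ {c b} → Rel (Class c b) 0ℓ
_≺_ = _<ₗₑₓ_ on vert

≺-isStrictTotalOrder : ∀ {c b} → IsStrictTotalOrder {A = Class c b} _≡_ _≺_
≺-isStrictTotalOrder = isStrictTotalOrder-≡ vert-injective
  (On.isStrictTotalOrder vert <ₗₑₓ-isStrictTotalOrder)

graph : ∀ {c} → (V → V) → EdgeSet c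
graph f v w = vert w ≡ f (vert v)

cograph : ∀ {c} → (V → V) → EdgeSet c
cograph f v w = vert v ≡ f (vert w)

module _ {c : V → Bool} {f : V → V} (f-mono : f Preserves _<ₗₑₓ_ ⟶ _<ₗₑₓ_) where

  private
    f-injective : ∀ {x y} → f x ≡ f y → x ≡ y
    f-injective = strictlyMonotone⇒injective <ₗₑₓ-isStrictTotalOrder f-mono

  graph-isMatching : (∀ v w → graph f v w → Adj (vert v) (vert w)) → IsMatching c (graph f)
  graph-isMatching adj =
      adj
    , (λ _ _ _ p q → vert-injective (trans p (sym q)))
    , (λ _ _ _ p q → vert-injective (f-injective (trans (sym p) q)))

  cograph-isMatching : (∀ v w → cograph f v w → Adj (vert v) (vert w)) → IsMatching c (cograph f)
  cograph-isMatching adj =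
      adj
    , (λ _ _ _ p q → vert-injective (f-injective (trans (sym p) q)))
    , (λ _ _ _ p q → vert-injective (trans p (sym q)))

  graph-isMonotone : IsMonotone c _≺_ _≺_ (graph f)
  graph-isMonotone _ (_ , _) _ (_ , _) refl refl v≺v' w'≺w = asym (f-mono v≺v') w'≺w

  cograph-isMonotone : IsMonotone c _≺_ _≺_ (cograph f)
  cograph-isMonotone (_ , _) _ (_ , _) _ refl refl v≺v' w'≺w = asym v≺v' (f-mono w'≺w)

right-graph-adj : ∀ {c} (v : Class c false) (w : Class c true) →
                  graph right v w → Adj (vert v) (vert w)
right-graph-adj ((_ , _) , _) _ refl = inj₁ (refl , refl)

right-cograph-adj : ∀ {c} (v : Class c false) (w : Class c true) →
                    cograph right v w → Adj (vert v) (vert w)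
right-cograph-adj _ ((_ , _) , _) refl = inj₂ (inj₁ (refl , refl))

up-graph-adj : ∀ (v : Class colour false) (w : Class colour true) →
               graph up v w → Adj (vert v) (vert w)
up-graph-adj ((x , y) , v-even) _ refl =
  inj₂ (inj₂ (inj₁ (refl , refl , colour≡false⇒Even {x} {y} v-even)))

wall-edges-covered : ∀ (v : Class colour false) (w : Class colour true) → Adj (vert v) (vert w) →
                     graph right v w ⊎ cograph right v w ⊎ graph up v w
wall-edges-covered ((_ , _) , _) _ (inj₁ (refl , refl))                  = inj₁ refl
wall-edges-covered ((_ , _) , _) _ (inj₂ (inj₁ (refl , refl)))           = inj₂ (inj₁ refl)
wall-edges-covered ((_ , _) , _) _ (inj₂ (inj₂ (inj₁ (refl , refl , _)))) = inj₂ (inj₂ refl)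
wall-edges-covered _ ((x , y) , w-odd) (inj₂ (inj₂ (inj₂ (refl , refl , x+y-even)))) =
  ⊥-elim (not-¬ w-odd (Even⇒colour≡false {x} {y} x+y-even))

lemma11 : ThreeMonotoneBipartite
lemma11 =
    colour , colour-proper
  , _≺_ , _≺_ , ≺-isStrictTotalOrder , ≺-isStrictTotalOrder
  , graph right , cograph right , graph up
  , (graph-isMatching right-mono-<ₗₑₓ right-graph-adj , graph-isMonotone right-mono-<ₗₑₓ)
  , (cograph-isMatching right-mono-<ₗₑₓ right-cograph-adj , cograph-isMonotone right-mono-<ₗₑₓ)
  , (graph-isMatching up-mono-<ₗₑₓ up-graph-adj , graph-isMonotone up-mono-<ₗₑₓ)
  , wall-edges-covered
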